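{- Let $n\ge 2$ and let $\mathcal{G} \subseteq \{\{1\}, \{1,2\}, \{1,2,3\}, \dots, \{1,2,\dots,n-1\}\}$. Then the number of full chains in $2^{[n]}$ containing no member of $\mathcal{G}$ is at least the number of full chains in $2^{[n]}$ containing at least one member of $\mathcal{G}$.
   Context: A full (maximal) chain in $2^{[n]}$ is a chain $\varnothing = A_0 \subset A_1 \subset \dots \subset A_n = [n]$ with $|A_i| = i$ for all $i$. -}

module Defs where

open import Data.Nat using (ℕ; zero; suc; _<_; _≤_; _≟_)
open import Data.Nat.Properties using (_<?_)
open import Data.Bool using (Bool; true; false)
import Data.Bool.Properties as B
open import Data.Fin using (Fin; toℕ; inject₁) renaming (suc to fsuc)
open import Data.Fin.Properties using (all?)
open import Data.Fin.Subset using (Subset; _⊆_; ∣_∣; inside; outside)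
open import Data.Fin.Subset.Properties using (_⊆?_)
open import Data.Vec using (Vec; []; _∷_; lookup; tabulate)
open import Data.Vec.Properties using (≡-dec)
open import Data.Vec.Membership.Propositional using (_∈_)
import Data.Vec.Membership.DecPropositional as VM
open import Data.List using (List; []; _∷_; map; concatMap; filter; length)
open import Data.List.Relation.Unary.Any using (Any)
import Data.List.Relation.Unary.Any as Any
open import Data.Product using (_×_; _,_)
open import Relation.Nullary using (Dec; yes; no; ¬_; ¬?)
open import Relation.Nullary.Decidable using (_×-dec_; does)
open import Relation.Binary.PropositionalEquality using (_≡_)

-- All subsets of [n] (a subset of [n] = {1..n} is encoded as a Subset n,
-- element i ∈ [n] corresponding to the index (i-1) : Fin n).
allSubsets : (n : ℕ) → List (Subset n)
allSubsets zero = [] ∷ []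
allSubsets (suc n) = concatMap (λ s → (outside ∷ s) ∷ (inside ∷ s) ∷ []) (allSubsets n)

allVecs : {A : Set} → List A → (m : ℕ) → List (Vec A m)
allVecs xs zero = [] ∷ []
allVecs xs (suc m) = concatMap (λ x → map (x ∷_) (allVecs xs m)) xs

-- A full chain A₀ ⊂ A₁ ⊂ … ⊂ Aₙ in 2^[n], represented as the vector (A₀,…,Aₙ):
-- each Aᵢ has exactly i elements and Aᵢ ⊆ Aᵢ₊₁ (hence A₀ = ∅, Aₙ = [n],
-- and the inclusions are strict).
IsFullChain : {n : ℕ} → Vec (Subset n) (suc n) → Set
IsFullChain {n} C =
  ((i : Fin (suc n)) → ∣ lookup C i ∣ ≡ toℕ i) ×
  ((i : Fin n) → lookup C (inject₁ i) ⊆ lookup C (fsuc i))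

isFullChain? : {n : ℕ} → (C : Vec (Subset n) (suc n)) → Dec (IsFullChain C)
isFullChain? C =
  all? (λ i → ∣ lookup C i ∣ ≟ toℕ i) ×-dec all? (λ i → lookup C (inject₁ i) ⊆? lookup C (fsuc i))

fullChains : (n : ℕ) → List (Vec (Subset n) (suc n))
fullChains n = filter isFullChain? (allVecs (allSubsets n) (suc n))

prefix : {n : ℕ} → ℕ → Subset n
prefix k = tabulate (λ i → does (toℕ i <? k))

ContainsSome : {n : ℕ} → List (Subset n) → Vec (Subset n) (suc n) → Set
ContainsSome 𝒢 C = Any (λ S → S ∈ C) 𝒢

containsSome? : {n : ℕ} → (𝒢 : List (Subset n)) → (C : Vec (Subset n) (suc n)) → Dec (ContainsSome 𝒢 C)
containsSome? 𝒢 C = Any.any? (λ S → VM._∈?_ (≡-dec B._≟_) S C) 𝒢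

#avoiding : {n : ℕ} → List (Subset n) → ℕ
#avoiding {n} 𝒢 = length (filter (λ C → ¬? (containsSome? 𝒢 C)) (fullChains n))

#meeting : {n : ℕ} → List (Subset n) → ℕ
#meeting {n} 𝒢 = length (filter (containsSome? 𝒢) (fullChains n))

module Submission where

-- Reflect [n] by i ↦ n + 1 − i (on the bit vectors encoding subsets this is
-- Vec reverse).  This maps full chains to full chains,
-- injectively, and sends the prefix {1,…,k} to the suffix {n−k+1,…,n}.  For
-- 1 ≤ j, k ≤ n − 1 a prefix and a suffix are incomparable (the prefix contains
-- 1 and the suffix does not, the suffix contains n and the prefix does not),
-- so they never lie on a common chain.  Hence the reflection of a chain
-- meeting 𝒢 avoids 𝒢, and reflection injects the meeting chains into the
-- avoiding ones.

open import Defs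
open import Data.Nat using (ℕ; zero; suc; _≤_; _<_; _∸_; z≤n; s≤s)
open import Data.Nat.Properties using (≤-total; ≤⇒≯; _<?_; module ≤-Reasoning)
open import Data.Bool using (Bool; true; false; if_then_else_; _≟_)
open import Data.Fin using (Fin; toℕ; inject₁; opposite; fromℕ) renaming (zero to fzero; suc to fsuc)
open import Data.Fin.Properties using (opposite-involutive; toℕ-fromℕ)
open import Data.Fin.Subset using (Subset; _⊆_; _∈_; inside; outside; ∣_∣)
open import Data.Fin.Subset.Properties using (⊆-trans; ⊆-refl)
open import Data.Vec using (Vec; []; _∷_; lookup; reverse; _∷ʳ_; count)
open import Data.Vec.Properties
  using (lookup-map; []=⇒lookup; lookup⇒[]=; ∷-injective; ∷-injectiveˡ; ∷-injectiveʳ; lookup∘tabulate; reverse-∷; reverse-injective)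
import Data.Vec as Vec
open import Data.Vec.Membership.Propositional using () renaming (_∈_ to _∈ᵥ_)
open import Data.Vec.Membership.Propositional.Properties using (∈-map⁺)
import Data.Vec.Relation.Unary.Any as VecAny
open import Data.Vec.Relation.Unary.Any.Properties using (lookup-index)
open import Data.List using (List; []; _∷_; length; filter; map; concatMap; cartesianProductWith; _++_)
open import Data.List.Properties using (length-map; length-++-sucʳ)
open import Data.List.Membership.Propositional using () renaming (_∈_ to _∈ₗ_)
open import Data.List.Membership.Propositional.Properties
  using (∈-filter⁺; ∈-filter⁻; ∈-cartesianProductWith⁺; ∈-∃++; ∈-++⁻; ∈-++⁺ˡ; ∈-++⁺ʳ; ∈-map⁻)
open import Data.List.Relation.Binary.Subset.Propositional using () renaming (_⊆_ to _⊆ₗ_)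
open import Data.List.Relation.Unary.Any using (here; there)
open import Data.List.Relation.Unary.All as All using (All; [])
open import Data.List.Relation.Unary.AllPairs using ([]; _∷_)
open import Data.List.Relation.Unary.Unique.Propositional using (Unique)
import Data.List.Relation.Unary.Unique.Propositional.Properties as Unique
open import Data.Product using (∃; _×_; _,_; proj₂)
open import Data.Sum using (_⊎_; inj₁; inj₂)
open import Function using (_∘_; id)
open import Function.Definitions using (Injective)
open import Data.Empty using (⊥-elim)
open import Relation.Nullary using (¬_; yes; no; does; ¬?)
open import Relation.Nullary.Decidable using (dec-true; dec-false)
open import Relation.Unary using (Pred; Decidable)
open import Relation.Binary.PropositionalEquality
  using (_≡_; refl; sym; trans; cong; cong₂; subst; subst₂; module ≡-Reasoning)

private
  variable
    A B : Set
    m n : ℕ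

lookup-∷ʳ-last : (xs : Vec A n) (x : A) → lookup (xs ∷ʳ x) (fromℕ n) ≡ x
lookup-∷ʳ-last []       x = refl
lookup-∷ʳ-last (y ∷ xs) x = lookup-∷ʳ-last xs x

lookup-∷ʳ-inject₁ : (xs : Vec A n) (x : A) (i : Fin n) → lookup (xs ∷ʳ x) (inject₁ i) ≡ lookup xs i
lookup-∷ʳ-inject₁ (y ∷ xs) x fzero    = refl
lookup-∷ʳ-inject₁ (y ∷ xs) x (fsuc i) = lookup-∷ʳ-inject₁ xs x i

lookup-reverse-opposite : (xs : Vec A n) (i : Fin n) → lookup (reverse xs) (opposite i) ≡ lookup xs i
lookup-reverse-opposite (x ∷ xs) i rewrite reverse-∷ x xs with i
... | fzero  = lookup-∷ʳ-last (reverse xs) x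
... | fsuc i = trans (lookup-∷ʳ-inject₁ (reverse xs) x (opposite i)) (lookup-reverse-opposite xs i)

lookup-reverse : (xs : Vec A n) (i : Fin n) → lookup (reverse xs) i ≡ lookup xs (opposite i)
lookup-reverse xs i = begin
  lookup (reverse xs) i                       ≡⟨ cong (lookup (reverse xs)) (opposite-involutive i) ⟨
  lookup (reverse xs) (opposite (opposite i)) ≡⟨ lookup-reverse-opposite xs (opposite i) ⟩
  lookup xs (opposite i)                      ∎
  where open ≡-Reasoning

module _ {p} {P : Pred A p} (P? : Decidable P) where

  private
    countStep : A → ℕ → ℕ
    countStep x = if does (P? x) then suc else id

    countStep-comm : ∀ x y c → countStep x (countStep y c) ≡ countStep y (countStep x c)
    countStep-comm x y c with does (P? x) | does (P? y)
    ... | true  | true  = refl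
    ... | true  | false = refl
    ... | false | true  = refl
    ... | false | false = refl

  count-∷ʳ : (xs : Vec A n) (x : A) → count P? (xs ∷ʳ x) ≡ count P? (x ∷ xs)
  count-∷ʳ []       x = refl
  count-∷ʳ (y ∷ xs) x = trans (cong (countStep y) (count-∷ʳ xs x)) (countStep-comm y x (count P? xs))

  count-reverse : (xs : Vec A n) → count P? (reverse xs) ≡ count P? xs
  count-reverse []       = refl
  count-reverse (x ∷ xs) = begin
    count P? (reverse (x ∷ xs))   ≡⟨ cong (count P?) (reverse-∷ x xs) ⟩
    count P? (reverse xs ∷ʳ x)    ≡⟨ count-∷ʳ (reverse xs) x ⟩
    countStep x (count P? (reverse xs)) ≡⟨ cong (countStep x) (count-reverse xs) ⟩
    count P? (x ∷ xs)             ∎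
    where open ≡-Reasoning

∈-reverse⁺ : {s : Subset n} {x : Fin n} → x ∈ s → opposite x ∈ reverse s
∈-reverse⁺ {s = s} {x} x∈s = lookup⇒[]= (opposite x) (reverse s)
  (trans (lookup-reverse-opposite s x) ([]=⇒lookup x∈s))

∈-reverse⁻ : {s : Subset n} {x : Fin n} → x ∈ reverse s → opposite x ∈ s
∈-reverse⁻ {s = s} {x} x∈rs = lookup⇒[]= (opposite x) s
  (trans (sym (lookup-reverse s x)) ([]=⇒lookup x∈rs))

reverse-mono-⊆ : {s t : Subset n} → s ⊆ t → reverse s ⊆ reverse t
reverse-mono-⊆ {t = t} s⊆t {x} x∈rs =
  subst (_∈ reverse t) (opposite-involutive x) (∈-reverse⁺ (s⊆t (∈-reverse⁻ x∈rs)))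

∣reverse∣ : (s : Subset n) → ∣ reverse s ∣ ≡ ∣ s ∣
∣reverse∣ = count-reverse (_≟ inside)

Chain : ℕ → Set
Chain n = Vec (Subset n) (suc n)

lookup-mono-⊆ : (C : Vec (Subset n) (suc m)) → (∀ i → lookup C (inject₁ i) ⊆ lookup C (fsuc i)) →
                ∀ i j → toℕ i ≤ toℕ j → lookup C i ⊆ lookup C j
lookup-mono-⊆ C step fzero fzero _ = ⊆-refl
lookup-mono-⊆ {m = suc _} (S ∷ C) step fzero (fsuc j) _ =
  ⊆-trans (step fzero) (lookup-mono-⊆ C (step ∘ fsuc) fzero j z≤n)
lookup-mono-⊆ {m = suc _} (S ∷ C) step (fsuc i) (fsuc j) (s≤s i≤j) =
  lookup-mono-⊆ C (step ∘ fsuc) i j i≤j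

IsFullChain⇒∈-comparable : {C : Chain n} {S T : Subset n} →
                           IsFullChain C → S ∈ᵥ C → T ∈ᵥ C → S ⊆ T ⊎ T ⊆ S
IsFullChain⇒∈-comparable {C = C} (_ , step) S∈C T∈C
  rewrite lookup-index S∈C | lookup-index T∈C
  with ≤-total (toℕ (VecAny.index S∈C)) (toℕ (VecAny.index T∈C))
... | inj₁ i≤j = inj₁ (lookup-mono-⊆ C step _ _ i≤j)
... | inj₂ j≤i = inj₂ (lookup-mono-⊆ C step _ _ j≤i)

reflect : Vec (Subset n) m → Vec (Subset n) m
reflect = Vec.map reverse

reflect-injective : Injective _≡_ _≡_ (reflect {n} {m})
reflect-injective {x = []}    {[]}    _  = refl
reflect-injective {x = S ∷ C} {T ∷ D} eq =
  cong₂ _∷_ (reverse-injective (∷-injectiveˡ eq)) (reflect-injective (∷-injectiveʳ eq))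

reflect-IsFullChain : {C : Chain n} → IsFullChain C → IsFullChain (reflect C)
reflect-IsFullChain {C = C} (size , step) =
  (λ i → trans (cong ∣_∣ (lookup-map i reverse C)) (trans (∣reverse∣ (lookup C i)) (size i))) ,
  (λ i → subst₂ _⊆_ (sym (lookup-map (inject₁ i) reverse C)) (sym (lookup-map (fsuc i) reverse C))
                    (reverse-mono-⊆ (step i)))

lookup-prefix : (k : ℕ) (x : Fin n) → lookup (prefix k) x ≡ does (toℕ x <? k)
lookup-prefix k = lookup∘tabulate _

∈-prefix⁺ : {k : ℕ} {x : Fin n} → toℕ x < k → x ∈ prefix k
∈-prefix⁺ {k = k} {x} x<k = lookup⇒[]= x (prefix k) (trans (lookup-prefix k x) (dec-true (toℕ x <? k) x<k))

∈-prefix⁻ : {k : ℕ} {x : Fin n} → x ∈ prefix k → toℕ x < k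
∈-prefix⁻ {k = k} {x} x∈p with toℕ x <? k
... | yes x<k = x<k
... | no  x≮k
  with () ← trans (sym ([]=⇒lookup x∈p)) (trans (lookup-prefix k x) (dec-false (toℕ x <? k) x≮k))

fromℕ∉prefix : {k : ℕ} → k ≤ n → ¬ (fromℕ n ∈ prefix k)
fromℕ∉prefix {n} k≤n n∈p = ≤⇒≯ k≤n (subst (_< _) (toℕ-fromℕ n) (∈-prefix⁻ n∈p))

-- The witnesses are 1 and n + 1, the indices fzero and fromℕ n = opposite fzero.
prefix-incomparable-reverse-prefix : {j k : ℕ} → 1 ≤ k → k ≤ n → 1 ≤ j → j ≤ n →
  ¬ (prefix {suc n} k ⊆ reverse (prefix j) ⊎ reverse (prefix j) ⊆ prefix k)
prefix-incomparable-reverse-prefix 1≤k k≤n 1≤j j≤n (inj₁ pk⊆rpj) =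
  fromℕ∉prefix j≤n (∈-reverse⁻ (pk⊆rpj (∈-prefix⁺ 1≤k)))
prefix-incomparable-reverse-prefix 1≤k k≤n 1≤j j≤n (inj₂ rpj⊆pk) =
  fromℕ∉prefix k≤n (rpj⊆pk (∈-reverse⁺ (∈-prefix⁺ 1≤j)))

prefix∈⇒prefix∉reflect : {C : Chain (suc n)} {j k : ℕ} → IsFullChain C →
  1 ≤ k → k ≤ n → 1 ≤ j → j ≤ n → prefix k ∈ᵥ C → ¬ (prefix j ∈ᵥ reflect C)
prefix∈⇒prefix∉reflect {C = C} C-full 1≤k k≤n 1≤j j≤n k∈C j∈rC =
  prefix-incomparable-reverse-prefix 1≤j j≤n 1≤k k≤n
    (IsFullChain⇒∈-comparable (reflect-IsFullChain {C = C} C-full) j∈rC (∈-map⁺ reverse k∈C))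

concatMap-map≡cartesianProductWith : {D : Set} (f : A → B → D) (xs : List A) (ys : List B) →
  concatMap (λ x → map (f x) ys) xs ≡ cartesianProductWith f xs ys
concatMap-map≡cartesianProductWith f []       ys = refl
concatMap-map≡cartesianProductWith f (x ∷ xs) ys =
  cong (map (f x) ys ++_) (concatMap-map≡cartesianProductWith f xs ys)

private
  bits : List Bool
  bits = outside ∷ inside ∷ []

  allSubsets-suc : (n : ℕ) → allSubsets (suc n) ≡ cartesianProductWith (λ s b → b ∷ s) (allSubsets n) bits
  allSubsets-suc n = concatMap-map≡cartesianProductWith (λ s b → b ∷ s) (allSubsets n) bits

  allVecs-suc : (xs : List A) (m : ℕ) → allVecs xs (suc m) ≡ cartesianProductWith _∷_ xs (allVecs xs m)
  allVecs-suc xs m = concatMap-map≡cartesianProductWith _∷_ xs (allVecs xs m)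

allSubsets-unique : (n : ℕ) → Unique (allSubsets n)
allSubsets-unique zero    = [] ∷ []
allSubsets-unique (suc n) rewrite allSubsets-suc n =
  Unique.cartesianProductWith⁺ (λ s b → b ∷ s) (λ eq → let b≡c , s≡t = ∷-injective eq in s≡t , b≡c)
    (allSubsets-unique n) (((λ ()) All.∷ []) ∷ [] ∷ [])

∈-allSubsets : (s : Subset n) → s ∈ₗ allSubsets n
∈-allSubsets []               = here refl
∈-allSubsets {suc n} (b ∷ s) rewrite allSubsets-suc n =
  ∈-cartesianProductWith⁺ (λ s b → b ∷ s) (∈-allSubsets s) (∈-bits b)
  where
  ∈-bits : (b : Bool) → b ∈ₗ bits
  ∈-bits false = here refl
  ∈-bits true  = there (here refl)

allVecs-unique : {xs : List A} → Unique xs → (m : ℕ) → Unique (allVecs xs m)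
allVecs-unique !xs zero    = [] ∷ []
allVecs-unique {xs = xs} !xs (suc m) rewrite allVecs-suc xs m =
  Unique.cartesianProductWith⁺ _∷_ ∷-injective !xs (allVecs-unique !xs m)

∈-allVecs : {xs : List A} → (∀ x → x ∈ₗ xs) → (v : Vec A m) → v ∈ₗ allVecs xs m
∈-allVecs                 all∈ []       = here refl
∈-allVecs {m = suc m} {xs} all∈ (x ∷ v) rewrite allVecs-suc xs m =
  ∈-cartesianProductWith⁺ _∷_ (all∈ x) (∈-allVecs all∈ v)

fullChains-unique : (n : ℕ) → Unique (fullChains n)
fullChains-unique n = Unique.filter⁺ isFullChain? (allVecs-unique (allSubsets-unique n) (suc n))

∈-fullChains⁺ : {C : Chain n} → IsFullChain C → C ∈ₗ fullChains n
∈-fullChains⁺ {C = C} = ∈-filter⁺ isFullChain? (∈-allVecs ∈-allSubsets C)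

∈-fullChains⁻ : {C : Chain n} → C ∈ₗ fullChains n → IsFullChain C
∈-fullChains⁻ {n} C∈ = proj₂ (∈-filter⁻ isFullChain? {xs = allVecs (allSubsets n) (suc n)} C∈)

Unique⇒length≤ : {xs ys : List A} → Unique xs → xs ⊆ₗ ys → length xs ≤ length ys
Unique⇒length≤ []             _      = z≤n
Unique⇒length≤ {xs = x ∷ xs} (x∉xs ∷ !xs) xs⊆ys
  with us , vs , refl ← ∈-∃++ (xs⊆ys (here refl)) = begin
    suc (length xs)         ≤⟨ s≤s (Unique⇒length≤ !xs xs⊆us++vs) ⟩
    suc (length (us ++ vs)) ≡⟨ length-++-sucʳ us x vs ⟨
    length (us ++ x ∷ vs)   ∎
  where
  open ≤-Reasoning
  xs⊆us++vs : xs ⊆ₗ us ++ vs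
  xs⊆us++vs y∈xs with ∈-++⁻ us (xs⊆ys (there y∈xs))
  ... | inj₁ y∈us        = ∈-++⁺ˡ y∈us
  ... | inj₂ (here y≡x)  = ⊥-elim (All.lookup x∉xs y∈xs (sym y≡x))
  ... | inj₂ (there y∈vs) = ∈-++⁺ʳ us y∈vs

length-filter-≤ : ∀ {p q} {P : Pred A p} {Q : Pred B q} (P? : Decidable P) (Q? : Decidable Q)
  {f : A → B} {xs : List A} {ys : List B} → Injective _≡_ _≡_ f → Unique xs →
  (∀ {x} → x ∈ₗ xs → P x → f x ∈ₗ ys × Q (f x)) → length (filter P? xs) ≤ length (filter Q? ys)
length-filter-≤ P? Q? {f} {xs} {ys} f-inj !xs maps-into = begin
  length (filter P? xs)         ≡⟨ length-map f (filter P? xs) ⟨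
  length (map f (filter P? xs)) ≤⟨ Unique⇒length≤ (Unique.map⁺ f-inj (Unique.filter⁺ P? !xs)) image⊆ ⟩
  length (filter Q? ys)         ∎
  where
  open ≤-Reasoning
  image⊆ : map f (filter P? xs) ⊆ₗ filter Q? ys
  image⊆ fx∈ with x , x∈ , refl ← ∈-map⁻ f fx∈ with x∈xs , Px ← ∈-filter⁻ P? x∈ =
    let fx∈ys , Qfx = maps-into x∈xs Px in ∈-filter⁺ Q? fx∈ys Qfx

lemma2p1 : (n : ℕ) → 2 ≤ n → (𝒢 : List (Subset n)) →
    All (λ S → ∃ (λ k → (1 ≤ k) × (k ≤ n ∸ 1) × (S ≡ prefix k))) 𝒢 →
    #meeting 𝒢 ≤ #avoiding 𝒢
lemma2p1 (suc (suc n)) (s≤s (s≤s z≤n)) 𝒢 𝒢-prefixes =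
  length-filter-≤ (containsSome? 𝒢) (λ C → ¬? (containsSome? 𝒢 C))
    reflect-injective (fullChains-unique _) reflect-meeting⇒avoiding
  where
  prefix∈ : {C : Chain (suc (suc n))} → ContainsSome 𝒢 C →
            ∃ λ k → 1 ≤ k × k ≤ suc n × prefix k ∈ᵥ C
  prefix∈ {C} meets with (k , 1≤k , k≤n , S≡k) , S∈C ← All.lookupAny 𝒢-prefixes meets =
    k , 1≤k , k≤n , subst (_∈ᵥ C) S≡k S∈C

  reflect-meeting⇒avoiding : {C : Chain (suc (suc n))} → C ∈ₗ fullChains _ → ContainsSome 𝒢 C →
                             reflect C ∈ₗ fullChains _ × ¬ ContainsSome 𝒢 (reflect C)
  reflect-meeting⇒avoiding {C} C∈ meets =
    ∈-fullChains⁺ (reflect-IsFullChain {C = C} C-full) , λ meets′ →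
      let k , 1≤k , k≤n , k∈C  = prefix∈ meets
          j , 1≤j , j≤n , j∈rC = prefix∈ meets′
      in prefix∈⇒prefix∉reflect C-full 1≤k k≤n 1≤j j≤n k∈C j∈rC
    where
    C-full : IsFullChain C
    C-full = ∈-fullChains⁻ C∈
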